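{- Let $I$ be a non-empty set and let $\mathbb{X}_i=\langle X_i,\rho_i\rangle$, $i\in I$, be pairwise disjoint non-empty tournaments such that the sequence of cardinals $\langle |X_i| : i\in I\rangle$ is reversible. Then the digraph $\bigcup_{i\in I}\mathbb{X}_i=\langle\bigcup_{i\in I}X_i,\bigcup_{i\in I}\rho_i\rangle$ is reversible. In particular, if $\mathbb{X}_i$, $i\in I$, are pairwise disjoint non-empty linear orders such that $\langle |X_i| : i\in I\rangle$ is reversible, then $\bigcup_{i\in I}\mathbb{X}_i$ is a reversible (disconnected, if $|I|>1$) partial order.
   Context: A tournament is a binary structure $\langle X,\rho\rangle$ with $\rho$ irreflexive and such that for all distinct $x,y\in X$ exactly one of $\langle x,y\rangle\in\rho$, $\langle y,x\rangle\in\rho$ holds. A binary structure $\mathbb{X}=\langle X,\rho\rangle$ is reversible iff every bijection $f:X\to X$ with $\langle x,y\rangle\in\rho\Rightarrow\langle f(x),f(y)\rangle\in\rho$ is an automorphism. A sequence of non-zero cardinals $\langle\kappa_i:i\in I\rangle$ is reversible iff there is no non-injective surjection $f:I\to I$ such that $\kappa_j=\sum_{i\in f^{ -1}[\{j\}]}\kappa_i$ for all $j\in I$. -}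

module Defs where

open import Data.Product using (Σ; ∃; ∃₂; _×_; _,_; proj₁)
open import Data.Sum using (_⊎_)
open import Relation.Nullary using (¬_)
open import Relation.Binary.PropositionalEquality using (_≡_; _≢_)
open import Function.Bundles using (_↔_)
open import Function.Definitions using (Injective)
open import Relation.Binary.Construct.Closure.ReflexiveTransitive using (Star)

Rel : Set → Set₁
Rel X = X → X → Set

Surj : {A B : Set} → (A → B) → Set
Surj {A} {B} f = ∀ (b : B) → ∃ λ (a : A) → f a ≡ b

Bij : {A : Set} → (A → A) → Set
Bij f = Injective _≡_ _≡_ f × Surj f

IsTournament : (X : Set) → Rel X → Set
IsTournament X ρ =
  (∀ x → ¬ ρ x x) ×
  (∀ x y → x ≢ y → (ρ x y ⊎ ρ y x) × ¬ (ρ x y × ρ y x))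

Reversible : (X : Set) → Rel X → Set
Reversible X ρ =
  ∀ (f : X → X) → Bij f → (∀ x y → ρ x y → ρ (f x) (f y)) →
  ∀ x y → ρ (f x) (f y) → ρ x y

Fiber : {I : Set} → (I → I) → I → Set
Fiber {I} f j = Σ I λ i → f i ≡ j

-- A sequence of cardinals ⟨|κ i| : i ∈ I⟩ (cardinals represented by sets κ i)
-- is reversible iff there is no non-injective surjection f : I → I with
-- |κ j| = Σ_{i ∈ f⁻¹[{j}]} |κ i| for all j (cardinal equality = bijection).
ReversibleSeq : (I : Set) → (I → Set) → Set
ReversibleSeq I κ =
  ¬ (Σ (I → I) λ f →
       Surj f × ¬ Injective _≡_ _≡_ f ×
       (∀ j → κ j ↔ Σ (Fiber f j) (λ p → κ (proj₁ p))))

-- Union of a pairwise disjoint family of binary structures: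
-- carrier ⋃ X i represented as the disjoint union Σ I X, relation ⋃ ρ i.
data Union {I : Set} {X : I → Set} (ρ : ∀ i → Rel (X i)) : Rel (Σ I X) where
  inU : ∀ {i x y} → ρ i x y → Union ρ (i , x) (i , y)

IsStrictLinearOrder : (X : Set) → Rel X → Set
IsStrictLinearOrder X ρ =
  (∀ x → ¬ ρ x x) ×
  (∀ x y z → ρ x y → ρ y z → ρ x z) ×
  (∀ x y → x ≢ y → ρ x y ⊎ ρ y x)

IsStrictPartialOrder : (X : Set) → Rel X → Set
IsStrictPartialOrder X ρ =
  (∀ x → ¬ ρ x x) ×
  (∀ x y z → ρ x y → ρ y z → ρ x z)

SymCl : {X : Set} → Rel X → Rel X
SymCl ρ x y = ρ x y ⊎ ρ y x

Disconnected : (X : Set) → Rel X → Set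
Disconnected X ρ = ∃₂ λ (x y : X) → ¬ Star (SymCl ρ) x y

-- Let f be a bijective homomorphism of ⋃ 𝕏ᵢ. Any two points of a tournament are
-- related, so f maps each component Xᵢ into a single component X_{g i}, and
-- surjectivity of f makes g surjective with |X_j| = Σ_{g i = j} |X_i|.
-- Reversibility of the sequence forces g to be injective, hence f restricts to
-- bijections Xᵢ → X_{g i}; a bijective homomorphism between tournaments is an
-- isomorphism since it cannot reverse an edge without violating asymmetry.
module Submission where

open import Defs
open import Level using (0ℓ)
open import Axiom.ExcludedMiddle using (ExcludedMiddle)
open import Data.Product using (Σ; ∃₂; _×_; _,_; proj₁; proj₂)
open import Data.Sum using (_⊎_; inj₁; inj₂)
open import Data.Empty using (⊥-elim)
open import Function.Base using (_∘_)
open import Function.Bundles using (_↔_; mk↔ₛ′)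
open import Function.Definitions using (Injective)
open import Relation.Nullary using (yes; no; ¬_)
open import Relation.Binary.PropositionalEquality
  using (_≡_; _≢_; refl; sym; trans; cong; subst)
open import Relation.Binary.Construct.Closure.ReflexiveTransitive using (Star; ε; _◅_)

module _ {X : Set} {ρ : Rel X} where

  IsStrictLinearOrder⇒IsTournament : IsStrictLinearOrder X ρ → IsTournament X ρ
  IsStrictLinearOrder⇒IsTournament (irrefl , trans′ , total) =
    irrefl , λ x y x≢y → total x y x≢y , λ (r , s) → irrefl x (trans′ x y x r s)

  IsStrictLinearOrder⇒IsStrictPartialOrder : IsStrictLinearOrder X ρ → IsStrictPartialOrder X ρ
  IsStrictLinearOrder⇒IsStrictPartialOrder (irrefl , trans′ , _) = irrefl , trans′

  tournament-asym : IsTournament X ρ → ∀ {x y} → ρ x y → ¬ ρ y x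
  tournament-asym (irrefl , exclusive) {x} {y} r s =
    proj₂ (exclusive x y (λ { refl → irrefl x r })) (r , s)

module _ {I : Set} {X : I → Set} {ρ : ∀ i → Rel (X i)} where

  Union-sameIndex : ∀ {p q} → Union ρ p q → proj₁ p ≡ proj₁ q
  Union-sameIndex (inU _) = refl

  Star-Union-sameIndex : ∀ {p q} → Star (SymCl (Union ρ)) p q → proj₁ p ≡ proj₁ q
  Star-Union-sameIndex ε                = refl
  Star-Union-sameIndex (inj₁ (inU _) ◅ s) = Star-Union-sameIndex s
  Star-Union-sameIndex (inj₂ (inU _) ◅ s) = Star-Union-sameIndex s

  Union-disconnected : (∀ i → X i) → (∃₂ λ (i j : I) → i ≢ j) → Disconnected (Σ I X) (Union ρ)
  Union-disconnected pt (i , j , i≢j) =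
    (i , pt i) , (j , pt j) , i≢j ∘ Star-Union-sameIndex

  Union-isStrictPartialOrder : (∀ i → IsStrictPartialOrder (X i) (ρ i)) →
                               IsStrictPartialOrder (Σ I X) (Union ρ)
  Union-isStrictPartialOrder spo =
    (λ { _ (inU r) → proj₁ (spo _) _ r }) ,
    (λ { _ _ _ (inU r) (inU s) → inU (proj₂ (spo _) _ _ _ r s) })

  Union-isTournament-asym : (∀ i → IsTournament (X i) (ρ i)) →
                            ∀ {p q} → Union ρ p q → ¬ Union ρ q p
  Union-isTournament-asym tour (inU r) (inU s) = tournament-asym (tour _) r s

  Union-hom-sameIndex : ExcludedMiddle 0ℓ → (∀ i x y → x ≢ y → ρ i x y ⊎ ρ i y x) →
    (f : Σ I X → Σ I X) → (∀ p q → Union ρ p q → Union ρ (f p) (f q)) →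
    ∀ i x y → proj₁ (f (i , x)) ≡ proj₁ (f (i , y))
  Union-hom-sameIndex em comparable f hom i x y with em {x ≡ y}
  ... | yes refl = refl
  ... | no x≢y with comparable i x y x≢y
  ...   | inj₁ r = Union-sameIndex (hom _ _ (inU r))
  ...   | inj₂ r = sym (Union-sameIndex (hom _ _ (inU r)))

module IndexPreserving {I : Set} {X : I → Set}
  (f : Σ I X → Σ I X) (g : I → I) (f-index : ∀ i x → proj₁ (f (i , x)) ≡ g i) where

  private
    subst-η : ∀ {j} p (e : proj₁ p ≡ j) → (j , subst X e (proj₂ p)) ≡ p
    subst-η _ refl = refl

    subst-proj₂ : ∀ {j a} q (e : proj₁ q ≡ j) → q ≡ (j , a) → subst X e (proj₂ q) ≡ a
    subst-proj₂ _ refl refl = refl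

    fibre-≡ : ∀ {i j x} q (π : g (proj₁ q) ≡ j) (e : g i ≡ j) → q ≡ (i , x) →
              _≡_ {A = Σ (Fiber g j) (X ∘ proj₁)} ((proj₁ q , π) , proj₂ q) ((i , e) , x)
    fibre-≡ _ refl refl refl = refl

  index-surjective : (∀ i → X i) → Surj f → Surj g
  index-surjective pt surj j with surj (j , pt j)
  ... | (i , x) , fix≡jpt = i , trans (sym (f-index i x)) (cong proj₁ fix≡jpt)

  fibre↔ : Bij f → ∀ j → X j ↔ Σ (Fiber g j) (X ∘ proj₁)
  fibre↔ (inj , surj) j = mk↔ₛ′ to from to∘from from∘to
    where
    to : X j → Σ (Fiber g j) (X ∘ proj₁)
    to a with surj (j , a)
    ... | (i , x) , fix≡ja = (i , trans (sym (f-index i x)) (cong proj₁ fix≡ja)) , x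

    from : Σ (Fiber g j) (X ∘ proj₁) → X j
    from ((i , gi≡j) , x) = subst X (trans (f-index i x) gi≡j) (proj₂ (f (i , x)))

    from∘to : ∀ a → from (to a) ≡ a
    from∘to a with surj (j , a)
    ... | (i , x) , fix≡ja = subst-proj₂ (f (i , x)) _ fix≡ja

    to∘from : ∀ y → to (from y) ≡ y
    to∘from ((i , gi≡j) , x) with surj (j , from ((i , gi≡j) , x))
    ... | q , fq≡ = fibre-≡ q _ gi≡j
      (inj (trans fq≡ (subst-η (f (i , x)) (trans (f-index i x) gi≡j))))

  index-injective : ExcludedMiddle 0ℓ → (∀ i → X i) → ReversibleSeq I X →
                    Bij f → Injective _≡_ _≡_ g
  index-injective em pt reversibleSeq bij with em {Injective _≡_ _≡_ g}
  ... | yes g-inj = g-inj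
  ... | no ¬g-inj =
    ⊥-elim (reversibleSeq (g , index-surjective pt (proj₂ bij) , ¬g-inj , fibre↔ bij))

module _ {I : Set} {X : I → Set} {ρ : ∀ i → Rel (X i)} where

  -- Points with related images are distinct (irreflexivity) and, g being injective,
  -- lie in one tournament; an edge between them the wrong way round would be
  -- mapped against asymmetry.
  Union-reflects : (∀ i → IsTournament (X i) (ρ i)) →
    (f : Σ I X → Σ I X) → (∀ p q → Union ρ p q → Union ρ (f p) (f q)) →
    (g : I → I) → (∀ i x → proj₁ (f (i , x)) ≡ g i) → Injective _≡_ _≡_ g →
    ∀ p q → Union ρ (f p) (f q) → Union ρ p q
  Union-reflects tour f hom g f-index g-inj (i , a) (k , b) r
    with g-inj (trans (sym (f-index i a)) (trans (Union-sameIndex r) (f-index k b)))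
  ... | refl with proj₁ (proj₂ (tour i) a b (λ { refl → Union-isTournament-asym tour r r }))
  ...   | inj₁ s = inU s
  ...   | inj₂ s = ⊥-elim (Union-isTournament-asym tour r (hom _ _ (inU s)))

  Union-reversible : ExcludedMiddle 0ℓ → (∀ i → X i) → ReversibleSeq I X →
    (∀ i → IsTournament (X i) (ρ i)) → Reversible (Σ I X) (Union ρ)
  Union-reversible em pt reversibleSeq tour f bij hom =
    Union-reflects tour f hom g f-index (index-injective em pt reversibleSeq bij)
    where
    g : I → I
    g i = proj₁ (f (i , pt i))

    f-index : ∀ i x → proj₁ (f (i , x)) ≡ g i
    f-index i x =
      Union-hom-sameIndex em (λ i x y x≢y → proj₁ (proj₂ (tour i) x y x≢y)) f hom i x (pt i)

    open IndexPreserving f g f-index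

theorem3p4 : ExcludedMiddle 0ℓ →
    (I : Set) → I →
    (X : I → Set) → (∀ i → X i) →
    ReversibleSeq I X →
    ((ρ : ∀ i → Rel (X i)) → (∀ i → IsTournament (X i) (ρ i)) →
      Reversible (Σ I X) (Union ρ))
    ×
    ((ρ : ∀ i → Rel (X i)) → (∀ i → IsStrictLinearOrder (X i) (ρ i)) →
      IsStrictPartialOrder (Σ I X) (Union ρ) ×
      Reversible (Σ I X) (Union ρ) ×
      ((∃₂ λ (i j : I) → i ≢ j) → Disconnected (Σ I X) (Union ρ)))
theorem3p4 em I _ X pt reversibleSeq =
  (λ ρ tour → Union-reversible em pt reversibleSeq tour) ,
  λ ρ lin →
    Union-isStrictPartialOrder (IsStrictLinearOrder⇒IsStrictPartialOrder ∘ lin) ,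
    Union-reversible em pt reversibleSeq (IsStrictLinearOrder⇒IsTournament ∘ lin) ,
    Union-disconnected pt
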